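{- Let $\mathbb{F}_q$ be a finite field and $r$ a positive integer. Let $f,g:\mathbb{F}_q^{2r+1}\to\mathbb{F}_q$ be linear local rules $f(x_0,\dots,x_{2r})=a_0x_0+\dots+a_{2r}x_{2r}$ and $g(x_0,\dots,x_{2r})=b_0x_0+\dots+b_{2r}x_{2r}$ with $a_0,a_{2r},b_0,b_{2r}\neq 0$ (so both rules are bipermutive). Let $\mathcal{F},\mathcal{G}:\mathbb{F}_q^{4r}\to\mathbb{F}_q^{2r}$ be the corresponding one-step cellular automata of length $4r$ and radius $r$, i.e. $\mathcal{F}(x)=(f(x_0,\dots,x_{2r}),f(x_1,\dots,x_{2r+1}),\dots,f(x_{2r-1},\dots,x_{4r-1}))$ and similarly for $\mathcal{G}$ with $g$. Let $M_{\mathcal{F}}$ and $M_{\mathcal{G}}$ be the $2r\times 4r$ matrices of these linear maps, where row $i$ ($0\le i\le 2r-1$) of $M_{\mathcal{F}}$ has entries $a_0,\dots,a_{2r}$ in columns $i,\dots,i+2r$ and zeros elsewhere (and analogously for $M_{\mathcal{G}}$ with $b_0,\dots,b_{2r}$), and let $M=\begin{pmatrix} M_{\mathcal{F}}\\ M_{\mathcal{G}}\end{pmatrix}$ be the $4r\times 4r$ matrix obtained by stacking them (a Sylvester matrix). Then the Latin squares $L_{\mathcal{F}}$ and $L_{\mathcal{G}}$ of order $q^{2r}$ generated by $\mathcal{F}$ and $\mathcal{G}$ are orthogonal if and only if $\det M\neq 0$ over $\mathbb{F}_q$.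
   Context: The square associated to a CA $\mathcal{F}:\mathbb{F}_q^{2m}\to\mathbb{F}_q^m$ (here $m=2r$) is defined by fixing a total order on $\mathbb{F}_q^m$ and a monotone bijection $\phi:\mathbb{F}_q^m\to\{1,\dots,q^m\}$ with inverse $\psi$, and setting $L_{\mathcal{F}}(i,j)=\phi(\mathcal{F}(\psi(i)\,\|\,\psi(j)))$, where $\|$ denotes concatenation; for bipermutive rules this square is a Latin square. Two Latin squares $L_1,L_2$ of order $v$ over $X$ are orthogonal if superposing them yields every pair in $X\times X$ exactly once, i.e. $(L_1(i_1,j_1),L_2(i_1,j_1))\neq(L_1(i_2,j_2),L_2(i_2,j_2))$ whenever $(i_1,j_1)\neq(i_2,j_2)$. -}

module Defs where

open import Level using (0ℓ)
open import Data.Nat as ℕ using (ℕ; zero; suc; _^_; _<_; _≤_)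
open import Data.Fin as Fin using (Fin; toℕ)
open import Data.Vec as Vec using (Vec; lookup; tabulate; _++_)
import Data.Sum
open import Data.Product using (_×_; _,_)
open import Relation.Nullary using (¬_)
open import Relation.Binary using (Rel; IsStrictTotalOrder)
open import Relation.Binary.PropositionalEquality using (_≡_)
open import Algebra.Structures using (IsCommutativeRing)

record FiniteField : Set₁ where
  infixl 6 _+_
  infixl 7 _*_
  field
    Carrier : Set
    _+_ _*_ : Carrier → Carrier → Carrier
    -_ : Carrier → Carrier
    0# 1# : Carrier
    isCommutativeRing : IsCommutativeRing _≡_ _+_ _*_ -_ 0# 1#
    0≢1 : ¬ (0# ≡ 1#)
    _⁻¹ : Carrier → Carrier
    inverseʳ : ∀ x → ¬ (x ≡ 0#) → x * (x ⁻¹) ≡ 1#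
    q : ℕ
    enum : Carrier → Fin q
    unenum : Fin q → Carrier
    unenum∘enum : ∀ x → unenum (enum x) ≡ x
    enum∘unenum : ∀ i → enum (unenum i) ≡ i

module _ (𝔽 : FiniteField) where
  open FiniteField 𝔽

  ∑ : ∀ {n} → (Fin n → Carrier) → Carrier
  ∑ {zero}  f = 0#
  ∑ {suc n} f = f Fin.zero + ∑ (λ i → f (Fin.suc i))

  -- reading a vector at a natural-number position (0 outside the range;
  -- only used at in-range positions below)
  at : ∀ {n} → Vec Carrier n → ℕ → Carrier
  at Vec.[] _ = 0#
  at (x Vec.∷ xs) zero = x
  at (x Vec.∷ xs) (suc k) = at xs k

  linearRule : (r : ℕ) → Vec Carrier (suc (2 ℕ.* r)) → Vec Carrier (suc (2 ℕ.* r)) → Carrier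
  linearRule r a x = ∑ (λ k → lookup a k * lookup x k)

  window : (r : ℕ) → Vec Carrier (2 ℕ.* r ℕ.+ 2 ℕ.* r) → ℕ → Vec Carrier (suc (2 ℕ.* r))
  window r x i = tabulate (λ k → at x (i ℕ.+ toℕ k))

  linearCA : (r : ℕ) → Vec Carrier (suc (2 ℕ.* r)) →
             Vec Carrier (2 ℕ.* r ℕ.+ 2 ℕ.* r) → Vec Carrier (2 ℕ.* r)
  linearCA r a x = tabulate (λ i → linearRule r a (window r x (toℕ i)))

  band : (r : ℕ) → Vec Carrier (suc (2 ℕ.* r)) → ℕ → ℕ → Carrier
  band r a i j with i ℕ.≤? j
  ... | Relation.Nullary.no _ = 0#
  ... | Relation.Nullary.yes _ = at a (j ℕ.∸ i)

  caMatrix : (r : ℕ) → Vec Carrier (suc (2 ℕ.* r)) →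
             Fin (2 ℕ.* r) → Fin (2 ℕ.* r ℕ.+ 2 ℕ.* r) → Carrier
  caMatrix r a i j = band r a (toℕ i) (toℕ j)

  stack : ∀ {m n} → (Fin m → Fin n → Carrier) → (Fin m → Fin n → Carrier) →
          Fin (m ℕ.+ m) → Fin n → Carrier
  stack {m} A B i j with Fin.splitAt m i
  ... | Data.Sum.inj₁ i' = A i' j
  ... | Data.Sum.inj₂ i' = B i' j

  sgn : ℕ → Carrier → Carrier
  sgn zero x = x
  sgn (suc k) x = - (sgn k x)

  det : ∀ {n} → (Fin n → Fin n → Carrier) → Carrier
  det {zero} M = 1#
  det {suc n} M =
    ∑ (λ j → sgn (toℕ j) (M Fin.zero j * det (λ i k → M (Fin.suc i) (Fin.punchIn j k))))

  -- A monotone bijection φ : 𝔽_q^m → {1,…,q^m} (here Fin (q^m), i.e. shifted by one)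
  -- with respect to a fixed strict total order on 𝔽_q^m, with inverse ψ.
  record MonotoneIndexing (m : ℕ) : Set₁ where
    field
      _≺_ : Rel (Vec Carrier m) 0ℓ
      isStrictTotalOrder : IsStrictTotalOrder _≡_ _≺_
      φ : Vec Carrier m → Fin (q ^ m)
      ψ : Fin (q ^ m) → Vec Carrier m
      ψ∘φ : ∀ x → ψ (φ x) ≡ x
      φ∘ψ : ∀ i → φ (ψ i) ≡ i
      monotone : ∀ x y → x ≺ y → toℕ (φ x) < toℕ (φ y)

  square : ∀ {m} → MonotoneIndexing m →
           (Vec Carrier (m ℕ.+ m) → Vec Carrier m) →
           Fin (q ^ m) → Fin (q ^ m) → Fin (q ^ m)
  square I F i j = φ (F (ψ i ++ ψ j))
    where open MonotoneIndexing I

Orthogonal : ∀ {v} → (Fin v → Fin v → Fin v) → (Fin v → Fin v → Fin v) → Set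
Orthogonal L₁ L₂ =
  ∀ i₁ j₁ i₂ j₂ → (L₁ i₁ j₁ , L₂ i₁ j₁) ≡ (L₁ i₂ j₂ , L₂ i₂ j₂) → (i₁ ≡ i₂ × j₁ ≡ j₂)

-- A linear CA F is the linear map with matrix M_F, and L_F(i, j) = φ (F (ψ i ‖ ψ j)) where φ, ψ are
-- mutually inverse bijections. Hence L_F and L_G are orthogonal iff v ↦ (F v, G v) is injective on 𝔽^{4r},
-- i.e. iff the square matrix M = (M_F over M_G) has trivial kernel, i.e. iff det M ≠ 0. The last step is
-- Gaussian elimination on the first column, which needs the Laplace-expansion determinant to be
-- multilinear and alternating in the rows.
module Submission where

open import Defs
open import Algebra.Bundles using (CommutativeRing)
import Algebra.Properties.CommutativeSemigroup as CommutativeSemigroupProperties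
import Algebra.Properties.Ring as RingProperties
import Algebra.Properties.Semiring.Sum as SemiringSum
open import Data.Empty using (⊥-elim)
open import Data.Fin as Fin using (Fin; zero; suc; toℕ; punchIn)
import Data.Fin.Properties as Fin
open import Data.Nat as ℕ using (ℕ; zero; suc)
import Data.Nat.Properties as ℕ
open import Data.Product using (_×_; _,_; proj₁; proj₂)
open import Data.Sum using (inj₁; inj₂)
open import Data.Vec as Vec using (Vec; lookup)
import Data.Vec.Properties as VecP
open import Data.Vec.Functional using (Vector; _∷_; removeAt; insertAt; updateAt)
open import Data.Vec.Functional.Properties
  using (map-updateAt-local; updateAt-updates; updateAt-minimal; updateAt-id-local; updateAt-commutes;
         insertAt-lookup; insertAt-punchIn)
open import Function.Base using (_∘_; const)
open import Function.Bundles using (_⇔_; mk⇔; mk↣; Equivalence)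
import Function.Properties.Equivalence as ⇔
open import Level using (0ℓ)
open import Relation.Binary.Definitions using (DecidableEquality)
import Relation.Binary.Reasoning.Setoid as SetoidReasoning
open import Relation.Binary.PropositionalEquality
  using (_≡_; _≢_; _≗_; refl; sym; trans; cong; cong₂; cong-app; subst; module ≡-Reasoning)
open import Relation.Nullary.Decidable using (yes; no; via-injection)
open import Relation.Nullary.Negation using (¬_)

module _ (𝔽 : FiniteField) where
  open ≡-Reasoning
  open FiniteField 𝔽

  commutativeRing : CommutativeRing _ _
  commutativeRing = record { isCommutativeRing = isCommutativeRing }

  open CommutativeRing commutativeRing
    using (+-assoc; +-comm; +-identityˡ; +-identityʳ; -‿inverseˡ; -‿inverseʳ;
           *-assoc; *-comm; *-identityˡ; *-identityʳ; zeroˡ; zeroʳ; distribˡ; distribʳ;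
           ring; semiring; *-commutativeSemigroup)
  open RingProperties ring
    using (-‿distribˡ-*; -‿distribʳ-*; -‿involutive; -0#≈0#; -‿+-comm; x∙y⁻¹≈ε⇒x≈y; +-inverseˡ-unique)
  open CommutativeSemigroupProperties *-commutativeSemigroup using (x∙yz≈y∙xz)
  module Sum = SemiringSum semiring

  infix 4 _≟_
  _≟_ : DecidableEquality Carrier
  _≟_ = via-injection (mk↣ enum-injective) Fin._≟_
    where
    enum-injective : ∀ {x y} → enum x ≡ enum y → x ≡ y
    enum-injective {x} {y} e = trans (sym (unenum∘enum x)) (trans (cong unenum e) (unenum∘enum y))

  x≢0⇒x*y≡0⇒y≡0 : ∀ {x y} → x ≢ 0# → x * y ≡ 0# → y ≡ 0#
  x≢0⇒x*y≡0⇒y≡0 {x} {y} x≢0 xy≡0 = begin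
    y               ≡⟨ sym (*-identityˡ y) ⟩
    1# * y          ≡⟨ cong (_* y) (sym (trans (*-comm _ _) (inverseʳ x x≢0))) ⟩
    (x ⁻¹ * x) * y  ≡⟨ *-assoc _ _ _ ⟩
    x ⁻¹ * (x * y)  ≡⟨ cong (x ⁻¹ *_) xy≡0 ⟩
    x ⁻¹ * 0#       ≡⟨ zeroʳ _ ⟩
    0#              ∎

  x≢0∧y≢0⇒x*y≢0 : ∀ {x y} → x ≢ 0# → y ≢ 0# → x * y ≢ 0#
  x≢0∧y≢0⇒x*y≢0 x≢0 y≢0 = y≢0 ∘ x≢0⇒x*y≡0⇒y≡0 x≢0

  ∑-cong : ∀ {n} {f g : Fin n → Carrier} → f ≗ g → ∑ 𝔽 f ≡ ∑ 𝔽 g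
  ∑-cong {zero}  f≗g = refl
  ∑-cong {suc n} f≗g = cong₂ _+_ (f≗g zero) (∑-cong (f≗g ∘ suc))

  ∑-zero : ∀ {n} {f : Fin n → Carrier} → f ≗ const 0# → ∑ 𝔽 f ≡ 0#
  ∑-zero {zero}  f≗0 = refl
  ∑-zero {suc n} f≗0 = trans (cong₂ _+_ (f≗0 zero) (∑-zero (f≗0 ∘ suc))) (+-identityˡ 0#)

  ∑≡sum : ∀ {n} (f : Fin n → Carrier) → ∑ 𝔽 f ≡ Sum.sum f
  ∑≡sum {zero}  f = refl
  ∑≡sum {suc n} f = cong (f zero +_) (∑≡sum (f ∘ suc))

  ∑-distrib-+ : ∀ {n} (f g : Fin n → Carrier) → ∑ 𝔽 (λ i → f i + g i) ≡ ∑ 𝔽 f + ∑ 𝔽 g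
  ∑-distrib-+ f g = begin
    ∑ 𝔽 (λ i → f i + g i)      ≡⟨ ∑≡sum (λ i → f i + g i) ⟩
    Sum.sum (λ i → f i + g i)  ≡⟨ Sum.∑-distrib-+ f g ⟩
    Sum.sum f + Sum.sum g      ≡⟨ sym (cong₂ _+_ (∑≡sum f) (∑≡sum g)) ⟩
    ∑ 𝔽 f + ∑ 𝔽 g              ∎

  ∑-comm : ∀ {m n} (f : Fin m → Fin n → Carrier) →
           ∑ 𝔽 (λ i → ∑ 𝔽 (f i)) ≡ ∑ 𝔽 (λ j → ∑ 𝔽 (λ i → f i j))
  ∑-comm f = begin
    ∑ 𝔽 (λ i → ∑ 𝔽 (f i))
      ≡⟨ trans (∑-cong (∑≡sum ∘ f)) (∑≡sum (λ i → Sum.sum (f i))) ⟩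
    Sum.sum (λ i → Sum.sum (f i))
      ≡⟨ Sum.∑-comm f ⟩
    Sum.sum (λ j → Sum.sum (λ i → f i j))
      ≡⟨ sym (trans (∑-cong (λ j → ∑≡sum (λ i → f i j))) (∑≡sum (λ j → Sum.sum (λ i → f i j)))) ⟩
    ∑ 𝔽 (λ j → ∑ 𝔽 (λ i → f i j)) ∎

  ∑-remove : ∀ {n} (i : Fin (suc n)) (f : Fin (suc n) → Carrier) → ∑ 𝔽 f ≡ f i + ∑ 𝔽 (removeAt f i)
  ∑-remove i f = begin
    ∑ 𝔽 f                         ≡⟨ ∑≡sum f ⟩
    Sum.sum f                     ≡⟨ Sum.sum-remove f ⟩
    f i + Sum.sum (removeAt f i)  ≡⟨ cong (f i +_) (sym (∑≡sum (removeAt f i))) ⟩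
    f i + ∑ 𝔽 (removeAt f i)      ∎

  ∑-insertAt-0# : ∀ {n} (f : Fin n → Carrier) i → ∑ 𝔽 (insertAt f i 0#) ≡ ∑ 𝔽 f
  ∑-insertAt-0# f i = begin
    ∑ 𝔽 (insertAt f i 0#)
      ≡⟨ ∑-remove i (insertAt f i 0#) ⟩
    insertAt f i 0# i + ∑ 𝔽 (removeAt (insertAt f i 0#) i)
      ≡⟨ cong₂ _+_ (insertAt-lookup f i 0#) (∑-cong (insertAt-punchIn f i 0#)) ⟩
    0# + ∑ 𝔽 f
      ≡⟨ +-identityˡ _ ⟩
    ∑ 𝔽 f ∎

  *-distribˡ-∑ : ∀ {n} (x : Carrier) (f : Fin n → Carrier) → x * ∑ 𝔽 f ≡ ∑ 𝔽 (λ i → x * f i)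
  *-distribˡ-∑ x f = begin
    x * ∑ 𝔽 f                ≡⟨ cong (x *_) (∑≡sum f) ⟩
    x * Sum.sum f            ≡⟨ Sum.*-distribˡ-sum x f ⟩
    Sum.sum (λ i → x * f i)  ≡⟨ sym (∑≡sum (λ i → x * f i)) ⟩
    ∑ 𝔽 (λ i → x * f i)      ∎

  -‿distrib-∑ : ∀ {n} (f : Fin n → Carrier) → - ∑ 𝔽 f ≡ ∑ 𝔽 (λ i → - f i)
  -‿distrib-∑ {zero}  f = -0#≈0#
  -‿distrib-∑ {suc n} f = trans (sym (-‿+-comm _ _)) (cong (- f zero +_) (-‿distrib-∑ (f ∘ suc)))

  ∑-linear : ∀ {n} (f : Fin n → Carrier) c g → ∑ 𝔽 (λ i → f i + c * g i) ≡ ∑ 𝔽 f + c * ∑ 𝔽 g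
  ∑-linear f c g = trans (∑-distrib-+ f (λ i → c * g i)) (cong (∑ 𝔽 f +_) (sym (*-distribˡ-∑ c g)))

  -- T is the part of G strictly above the diagonal; writing G = T - Tᵀ avoids halving, which
  -- characteristic 2 would forbid.
  ∑∑-antisymmetric : ∀ {n} (G : Fin n → Fin n → Carrier) → (∀ a → G a a ≡ 0#) →
                     (∀ a b → toℕ b ℕ.< toℕ a → G a b ≡ - G b a) → ∑ 𝔽 (λ a → ∑ 𝔽 (G a)) ≡ 0#
  ∑∑-antisymmetric {n} G diagonal antisymmetric = begin
    ∑ 𝔽 (λ a → ∑ 𝔽 (G a))
      ≡⟨ ∑-cong (λ a → ∑-cong (G≡T-Tᵀ a)) ⟩
    ∑ 𝔽 (λ a → ∑ 𝔽 (λ b → T a b + - T b a))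
      ≡⟨ ∑-cong splitRow ⟩
    ∑ 𝔽 (λ a → ∑ 𝔽 (T a) + - ∑ 𝔽 (λ b → T b a))
      ≡⟨ ∑-distrib-+ (λ a → ∑ 𝔽 (T a)) (λ a → - ∑ 𝔽 (λ b → T b a)) ⟩
    ∑T + ∑ 𝔽 (λ a → - ∑ 𝔽 (λ b → T b a))
      ≡⟨ cong (∑T +_) (sym (-‿distrib-∑ (λ a → ∑ 𝔽 (λ b → T b a)))) ⟩
    ∑T + - ∑ 𝔽 (λ a → ∑ 𝔽 (λ b → T b a))
      ≡⟨ cong (λ s → ∑T + - s) (sym (∑-comm T)) ⟩
    ∑T + - ∑T
      ≡⟨ -‿inverseʳ ∑T ⟩
    0# ∎
    where
    T : Fin n → Fin n → Carrier
    T a b with toℕ a ℕ.<? toℕ b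
    ... | yes _ = G a b
    ... | no  _ = 0#

    ∑T : Carrier
    ∑T = ∑ 𝔽 (λ a → ∑ 𝔽 (T a))

    G≡T-Tᵀ : ∀ a b → G a b ≡ T a b + - T b a
    G≡T-Tᵀ a b with toℕ a ℕ.<? toℕ b | toℕ b ℕ.<? toℕ a
    ... | yes a<b | yes b<a = ⊥-elim (ℕ.<-asym a<b b<a)
    ... | yes _   | no  _   = sym (trans (cong (G a b +_) -0#≈0#) (+-identityʳ _))
    ... | no  _   | yes b<a = trans (antisymmetric a b b<a) (sym (+-identityˡ _))
    ... | no  a≮b | no  b≮a with Fin.toℕ-injective (ℕ.≤-antisym (ℕ.≮⇒≥ b≮a) (ℕ.≮⇒≥ a≮b))
    ...   | refl = trans (diagonal a) (sym (trans (+-identityˡ _) -0#≈0#))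

    splitRow : ∀ a → ∑ 𝔽 (λ b → T a b + - T b a) ≡ ∑ 𝔽 (T a) + - ∑ 𝔽 (λ b → T b a)
    splitRow a = trans (∑-distrib-+ (T a) (λ b → - T b a))
                       (cong (∑ 𝔽 (T a) +_) (sym (-‿distrib-∑ (λ b → T b a))))

  sgn-+ : ∀ k x y → sgn 𝔽 k (x + y) ≡ sgn 𝔽 k x + sgn 𝔽 k y
  sgn-+ zero    x y = refl
  sgn-+ (suc k) x y = trans (cong -_ (sgn-+ k x y)) (sym (-‿+-comm _ _))

  sgn-*ʳ : ∀ k x y → sgn 𝔽 k (x * y) ≡ x * sgn 𝔽 k y
  sgn-*ʳ zero    x y = refl
  sgn-*ʳ (suc k) x y = trans (cong -_ (sgn-*ʳ k x y)) (-‿distribʳ-* x _)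

  sgn-linear : ∀ k x c y → sgn 𝔽 k (x + c * y) ≡ sgn 𝔽 k x + c * sgn 𝔽 k y
  sgn-linear k x c y = trans (sgn-+ k x (c * y)) (cong (sgn 𝔽 k x +_) (sgn-*ʳ k c y))

  sgn-zero : ∀ k → sgn 𝔽 k 0# ≡ 0#
  sgn-zero zero    = refl
  sgn-zero (suc k) = trans (cong -_ (sgn-zero k)) -0#≈0#

  sgn-*-≡0 : ∀ k x {d} → d ≡ 0# → sgn 𝔽 k (x * d) ≡ 0#
  sgn-*-≡0 k x d≡0 = trans (cong (λ d → sgn 𝔽 k (x * d)) d≡0) (trans (cong (sgn 𝔽 k) (zeroʳ x)) (sgn-zero k))

  sgn-neg : ∀ k x → sgn 𝔽 k (- x) ≡ - sgn 𝔽 k x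
  sgn-neg zero    x = refl
  sgn-neg (suc k) x = cong -_ (sgn-neg k x)

  sgn-comm : ∀ k l x → sgn 𝔽 k (sgn 𝔽 l x) ≡ sgn 𝔽 l (sgn 𝔽 k x)
  sgn-comm zero    l x = refl
  sgn-comm (suc k) l x = trans (cong -_ (sgn-comm k l x)) (sym (sgn-neg l _))

  sgn-∑ : ∀ k {n} (f : Fin n → Carrier) → sgn 𝔽 k (∑ 𝔽 f) ≡ ∑ 𝔽 (sgn 𝔽 k ∘ f)
  sgn-∑ zero    f = refl
  sgn-∑ (suc k) f = trans (cong -_ (sgn-∑ k f)) (-‿distrib-∑ (sgn 𝔽 k ∘ f))

  toℕ-punchIn-below : ∀ {n} (i : Fin (suc n)) j → toℕ (punchIn i j) ℕ.< toℕ i → toℕ (punchIn i j) ≡ toℕ j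
  toℕ-punchIn-below (suc i) zero    _         = refl
  toℕ-punchIn-below (suc i) (suc j) (ℕ.s≤s p) = cong suc (toℕ-punchIn-below i j p)

  toℕ-punchIn-above : ∀ {n} (i : Fin (suc n)) j → toℕ i ℕ.< toℕ (punchIn i j) →
                      toℕ i ℕ.≤ toℕ j × toℕ (punchIn i j) ≡ suc (toℕ j)
  toℕ-punchIn-above zero    j       _         = ℕ.z≤n , refl
  toℕ-punchIn-above (suc i) (suc j) (ℕ.s≤s p) with toℕ-punchIn-above i j p
  ... | i≤j , eq = ℕ.s≤s i≤j , cong suc eq

  punchIn-punchIn : ∀ {n} (i : Fin (suc n)) (j : Fin (suc (suc n))) (k : Fin (suc n)) →
                    toℕ k ≡ toℕ j → toℕ j ℕ.≤ toℕ i →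
                    ∀ l → punchIn (suc i) (punchIn k l) ≡ punchIn j (punchIn i l)
  punchIn-punchIn i       zero    zero    _  _         l       = refl
  punchIn-punchIn (suc i) (suc j) (suc k) eq (ℕ.s≤s le) zero    = refl
  punchIn-punchIn (suc i) (suc j) (suc k) eq (ℕ.s≤s le) (suc l) =
    cong suc (punchIn-punchIn i j k (ℕ.suc-injective eq) le l)

  -- Determinants

  Matrix : ℕ → Set
  Matrix n = Fin n → Fin n → Carrier

  minor : ∀ {n} → Matrix (suc n) → Fin (suc n) → Matrix n
  minor M j i k = M (suc i) (punchIn j k)

  infixl 6 _[_]≔_
  _[_]≔_ : ∀ {n} → Matrix n → Fin n → Vector Carrier n → Matrix n
  M [ i ]≔ x = updateAt M i (const x)

  ≔-cong : ∀ {n} {A B : Matrix n} → (∀ a → A a ≗ B a) → ∀ i x a → (A [ i ]≔ x) a ≗ (B [ i ]≔ x) a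
  ≔-cong {A = A} {B} A≗B i x a with a Fin.≟ i
  ... | yes refl = λ k → trans (cong-app (updateAt-updates a A) k) (sym (cong-app (updateAt-updates a B) k))
  ... | no  a≢i  = λ k → trans (cong-app (updateAt-minimal a i A a≢i) k)
                               (trans (A≗B a k) (sym (cong-app (updateAt-minimal a i B a≢i) k)))

  ≔-id : ∀ {n} (M : Matrix n) i a → (M [ i ]≔ M i) a ≗ M a
  ≔-id M i a = cong-app (updateAt-id-local i M refl a)

  ≔≔-first : ∀ {n} (M : Matrix n) {i j} x y → i ≢ j → (M [ i ]≔ x [ j ]≔ y) i ≡ x
  ≔≔-first M {i} {j} x y i≢j = trans (updateAt-minimal i j (M [ i ]≔ x) i≢j) (updateAt-updates i M)

  minor-≔ : ∀ {n} (M : Matrix (suc n)) i x k a →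
            minor (M [ suc i ]≔ x) k a ≗ (minor M k [ i ]≔ removeAt x k) a
  minor-≔ M i x k a = cong-app (map-updateAt-local {f = _∘ punchIn k} (M ∘ suc) i refl a)

  det-cong : ∀ {n} {M N : Matrix n} → (∀ i → M i ≗ N i) → det 𝔽 M ≡ det 𝔽 N
  det-cong {zero}  M≗N = refl
  det-cong {suc n} M≗N = ∑-cong λ j → cong (sgn 𝔽 (toℕ j))
    (cong₂ _*_ (M≗N zero j) (det-cong (λ i k → M≗N (suc i) (punchIn j k))))

  det-linearAt : ∀ {n} (M : Matrix n) i c (x y z : Vector Carrier n) → (∀ k → z k ≡ x k + c * y k) →
                 det 𝔽 (M [ i ]≔ z) ≡ det 𝔽 (M [ i ]≔ x) + c * det 𝔽 (M [ i ]≔ y)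
  det-linearAt {suc n} M zero c x y z z≡x+cy = begin
    ∑ 𝔽 (λ k → sgn 𝔽 (toℕ k) (z k * d k))
      ≡⟨ ∑-cong (λ k → trans (cong (λ w → sgn 𝔽 (toℕ k) (w * d k)) (z≡x+cy k))
                             (expand (toℕ k) (x k) (y k) (d k))) ⟩
    ∑ 𝔽 (λ k → sgn 𝔽 (toℕ k) (x k * d k) + c * sgn 𝔽 (toℕ k) (y k * d k))
      ≡⟨ ∑-linear (λ k → sgn 𝔽 (toℕ k) (x k * d k)) c (λ k → sgn 𝔽 (toℕ k) (y k * d k)) ⟩
    det 𝔽 (M [ zero ]≔ x) + c * det 𝔽 (M [ zero ]≔ y) ∎
    where
    d : Fin (suc n) → Carrier
    d k = det 𝔽 (minor M k)
    expand : ∀ l a b e → sgn 𝔽 l ((a + c * b) * e) ≡ sgn 𝔽 l (a * e) + c * sgn 𝔽 l (b * e)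
    expand l a b e = trans (cong (sgn 𝔽 l) (trans (distribʳ e a (c * b)) (cong (a * e +_) (*-assoc c b e))))
                           (sgn-linear l (a * e) c (b * e))
  det-linearAt {suc n} M (suc i) c x y z z≡x+cy = begin
    ∑ 𝔽 (λ k → sgn 𝔽 (toℕ k) (M zero k * d z k))
      ≡⟨ ∑-cong (λ k → trans (cong (λ w → sgn 𝔽 (toℕ k) (M zero k * w)) (minorLinear k))
                             (expand (toℕ k) (M zero k) (d x k) (d y k))) ⟩
    ∑ 𝔽 (λ k → sgn 𝔽 (toℕ k) (M zero k * d x k) + c * sgn 𝔽 (toℕ k) (M zero k * d y k))
      ≡⟨ ∑-linear (λ k → sgn 𝔽 (toℕ k) (M zero k * d x k)) c (λ k → sgn 𝔽 (toℕ k) (M zero k * d y k)) ⟩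
    det 𝔽 (M [ suc i ]≔ x) + c * det 𝔽 (M [ suc i ]≔ y) ∎
    where
    d : Vector Carrier (suc n) → Fin (suc n) → Carrier
    d w k = det 𝔽 (minor (M [ suc i ]≔ w) k)
    minorLinear : ∀ k → d z k ≡ d x k + c * d y k
    minorLinear k = begin
      d z k
        ≡⟨ det-cong (minor-≔ M i z k) ⟩
      det 𝔽 (minor M k [ i ]≔ removeAt z k)
        ≡⟨ det-linearAt (minor M k) i c (removeAt x k) (removeAt y k) (removeAt z k) (z≡x+cy ∘ punchIn k) ⟩
      det 𝔽 (minor M k [ i ]≔ removeAt x k) + c * det 𝔽 (minor M k [ i ]≔ removeAt y k)
        ≡⟨ sym (cong₂ (λ u v → u + c * v) (det-cong (minor-≔ M i x k)) (det-cong (minor-≔ M i y k))) ⟩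
      d x k + c * d y k ∎
    expand : ∀ l m a b → sgn 𝔽 l (m * (a + c * b)) ≡ sgn 𝔽 l (m * a) + c * sgn 𝔽 l (m * b)
    expand l m a b = trans (cong (sgn 𝔽 l) (trans (distribˡ m a (c * b)) (cong (m * a +_) (x∙yz≈y∙xz m c b))))
                           (sgn-linear l (m * a) c (m * b))

  det-additiveAt : ∀ {n} (M : Matrix n) i (x y : Vector Carrier n) →
                   det 𝔽 (M [ i ]≔ (λ k → x k + y k)) ≡ det 𝔽 (M [ i ]≔ x) + det 𝔽 (M [ i ]≔ y)
  det-additiveAt M i x y =
    trans (det-linearAt M i 1# x y (λ k → x k + y k) (λ k → cong (x k +_) (sym (*-identityˡ (y k)))))
          (cong (det 𝔽 (M [ i ]≔ x) +_) (*-identityˡ _))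

  mutual
    det-firstColumn : ∀ {n} (M : Matrix (suc n)) → (∀ i → M (suc i) zero ≡ 0#) →
                      det 𝔽 M ≡ M zero zero * det 𝔽 (λ i k → M (suc i) (suc k))
    det-firstColumn {zero}  M _       = +-identityʳ _
    det-firstColumn {suc n} M below≡0 =
      trans (cong (M zero zero * det 𝔽 (minor M zero) +_) (∑-zero λ j →
               sgn-*-≡0 (suc (toℕ j)) (M zero (suc j)) (det-zeroColumn (minor M (suc j)) below≡0)))
            (+-identityʳ _)

    det-zeroColumn : ∀ {n} (M : Matrix (suc n)) → (∀ i → M i zero ≡ 0#) → det 𝔽 M ≡ 0#
    det-zeroColumn M column≡0 =
      trans (det-firstColumn M (column≡0 ∘ suc))
            (trans (cong (_* det 𝔽 (λ i k → M (suc i) (suc k))) (column≡0 zero)) (zeroˡ _))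

  det-negateMinors : ∀ {n} (M N : Matrix (suc n)) → M zero ≗ N zero →
                     (∀ k → det 𝔽 (minor N k) ≡ - det 𝔽 (minor M k)) → det 𝔽 N ≡ - det 𝔽 M
  det-negateMinors M N M₀≗N₀ minors =
    trans (∑-cong term) (sym (-‿distrib-∑ (λ k → sgn 𝔽 (toℕ k) (M zero k * det 𝔽 (minor M k)))))
    where
    term : ∀ k → sgn 𝔽 (toℕ k) (N zero k * det 𝔽 (minor N k))
               ≡ - sgn 𝔽 (toℕ k) (M zero k * det 𝔽 (minor M k))
    term k = begin
      sgn 𝔽 (toℕ k) (N zero k * det 𝔽 (minor N k))
        ≡⟨ cong₂ (λ x d → sgn 𝔽 (toℕ k) (x * d)) (sym (M₀≗N₀ k)) (minors k) ⟩
      sgn 𝔽 (toℕ k) (M zero k * - det 𝔽 (minor M k))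
        ≡⟨ cong (sgn 𝔽 (toℕ k)) (sym (-‿distribʳ-* _ _)) ⟩
      sgn 𝔽 (toℕ k) (- (M zero k * det 𝔽 (minor M k)))
        ≡⟨ sgn-neg (toℕ k) _ ⟩
      - sgn 𝔽 (toℕ k) (M zero k * det 𝔽 (minor M k)) ∎

  -- Expanding along the first two rows gives a sum over pairs (j, j′) of distinct columns, encoded as
  -- G j j′ with G j j = 0; the terms of (j, j′) and (j′, j) differ only in sign.
  det-equalRows₀₁ : ∀ {n} (M : Matrix (suc (suc n))) → M (suc zero) ≗ M zero → det 𝔽 M ≡ 0#
  det-equalRows₀₁ {n} M M₁≗M₀ = begin
    det 𝔽 M                  ≡⟨ ∑-cong expand ⟩
    ∑ 𝔽 (λ j → ∑ 𝔽 (P j))    ≡⟨ ∑-cong (λ j → sym (∑-insertAt-0# (P j) j)) ⟩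
    ∑ 𝔽 (λ j → ∑ 𝔽 (G j))    ≡⟨ ∑∑-antisymmetric G (λ j → insertAt-lookup (P j) j 0#) G-antisymmetric ⟩
    0#                       ∎
    where
    u : Vector Carrier (suc (suc n))
    u = M zero

    D : Fin (suc (suc n)) → Fin (suc n) → Carrier
    D j k = det 𝔽 (minor (minor M j) k)

    P : Fin (suc (suc n)) → Fin (suc n) → Carrier
    P j k = sgn 𝔽 (toℕ j) (sgn 𝔽 (toℕ k) (u j * (u (punchIn j k) * D j k)))

    G : Fin (suc (suc n)) → Fin (suc (suc n)) → Carrier
    G j = insertAt (P j) j 0#

    expand : ∀ j → sgn 𝔽 (toℕ j) (u j * det 𝔽 (minor M j)) ≡ ∑ 𝔽 (P j)
    expand j = begin
      sgn 𝔽 (toℕ j) (u j * ∑ 𝔽 (λ k → sgn 𝔽 (toℕ k) (M (suc zero) (punchIn j k) * D j k)))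
        ≡⟨ cong (λ s → sgn 𝔽 (toℕ j) (u j * s))
                (∑-cong (λ k → cong (λ x → sgn 𝔽 (toℕ k) (x * D j k)) (M₁≗M₀ (punchIn j k)))) ⟩
      sgn 𝔽 (toℕ j) (u j * ∑ 𝔽 (λ k → sgn 𝔽 (toℕ k) (u (punchIn j k) * D j k)))
        ≡⟨ cong (sgn 𝔽 (toℕ j)) (*-distribˡ-∑ (u j) (λ k → sgn 𝔽 (toℕ k) (u (punchIn j k) * D j k))) ⟩
      sgn 𝔽 (toℕ j) (∑ 𝔽 (λ k → u j * sgn 𝔽 (toℕ k) (u (punchIn j k) * D j k)))
        ≡⟨ sgn-∑ (toℕ j) (λ k → u j * sgn 𝔽 (toℕ k) (u (punchIn j k) * D j k)) ⟩
      ∑ 𝔽 (λ k → sgn 𝔽 (toℕ j) (u j * sgn 𝔽 (toℕ k) (u (punchIn j k) * D j k)))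
        ≡⟨ ∑-cong (λ k → cong (sgn 𝔽 (toℕ j)) (sym (sgn-*ʳ (toℕ k) (u j) (u (punchIn j k) * D j k)))) ⟩
      ∑ 𝔽 (P j) ∎

    P-antisymmetric : ∀ a b k₁ k₂ → toℕ b ℕ.< toℕ a → punchIn a k₁ ≡ b → punchIn b k₂ ≡ a →
                      P a k₁ ≡ - P b k₂
    P-antisymmetric a b k₁ k₂ b<a a↑k₁≡b b↑k₂≡a = begin
      sgn 𝔽 (toℕ a) (sgn 𝔽 (toℕ k₁) (u a * (u (punchIn a k₁) * D a k₁)))
        ≡⟨ cong₂ (λ s t → sgn 𝔽 s (sgn 𝔽 t (u a * (u (punchIn a k₁) * D a k₁)))) a≡1+k₂ (sym b≡k₁) ⟩
      - sgn 𝔽 (toℕ k₂) (sgn 𝔽 (toℕ b) (u a * (u (punchIn a k₁) * D a k₁)))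
        ≡⟨ cong -_ (sgn-comm (toℕ k₂) (toℕ b) _) ⟩
      - sgn 𝔽 (toℕ b) (sgn 𝔽 (toℕ k₂) (u a * (u (punchIn a k₁) * D a k₁)))
        ≡⟨ cong (λ x → - sgn 𝔽 (toℕ b) (sgn 𝔽 (toℕ k₂) x)) swapFactors ⟩
      - P b k₂ ∎
      where
      b≡k₁ : toℕ b ≡ toℕ k₁
      b≡k₁ = trans (cong toℕ (sym a↑k₁≡b))
                   (toℕ-punchIn-below a k₁ (subst (λ c → toℕ c ℕ.< toℕ a) (sym a↑k₁≡b) b<a))
      above : toℕ b ℕ.≤ toℕ k₂ × toℕ (punchIn b k₂) ≡ suc (toℕ k₂)
      above = toℕ-punchIn-above b k₂ (subst (λ c → toℕ b ℕ.< toℕ c) (sym b↑k₂≡a) b<a)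
      a≡1+k₂ : toℕ a ≡ suc (toℕ k₂)
      a≡1+k₂ = trans (cong toℕ (sym b↑k₂≡a)) (proj₂ above)
      D≡D : D a k₁ ≡ D b k₂
      D≡D = det-cong λ i l → cong (M (suc (suc i)))
        (trans (cong (λ z → punchIn z (punchIn k₁ l)) (Fin.toℕ-injective a≡1+k₂))
               (punchIn-punchIn k₂ b k₁ (sym b≡k₁) (proj₁ above) l))
      swapFactors : u a * (u (punchIn a k₁) * D a k₁) ≡ u b * (u (punchIn b k₂) * D b k₂)
      swapFactors = begin
        u a * (u (punchIn a k₁) * D a k₁)  ≡⟨ cong (λ c → u a * (u c * D a k₁)) a↑k₁≡b ⟩
        u a * (u b * D a k₁)               ≡⟨ x∙yz≈y∙xz (u a) (u b) (D a k₁) ⟩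
        u b * (u a * D a k₁)               ≡⟨ cong₂ (λ c d → u b * (u c * d)) (sym b↑k₂≡a) D≡D ⟩
        u b * (u (punchIn b k₂) * D b k₂)  ∎

    G-antisymmetric : ∀ a b → toℕ b ℕ.< toℕ a → G a b ≡ - G b a
    G-antisymmetric a b b<a = begin
      G a b                 ≡⟨ cong (G a) (sym (Fin.punchIn-punchOut a≢b)) ⟩
      G a (punchIn a k₁)    ≡⟨ insertAt-punchIn (P a) a 0# k₁ ⟩
      P a k₁                ≡⟨ P-antisymmetric a b k₁ k₂ b<a (Fin.punchIn-punchOut a≢b)
                                                             (Fin.punchIn-punchOut b≢a) ⟩
      - P b k₂              ≡⟨ cong -_ (sym (insertAt-punchIn (P b) b 0# k₂)) ⟩
      - G b (punchIn b k₂)  ≡⟨ cong (λ c → - G b c) (Fin.punchIn-punchOut b≢a) ⟩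
      - G b a               ∎
      where
      b≢a : b ≢ a
      b≢a b≡a = ℕ.<-irrefl (cong toℕ b≡a) b<a
      a≢b : a ≢ b
      a≢b = b≢a ∘ sym
      k₁ = Fin.punchOut a≢b
      k₂ = Fin.punchOut b≢a

  Alternating : ℕ → Set
  Alternating n = ∀ (M : Matrix n) {i j} → i ≢ j → M i ≗ M j → det 𝔽 M ≡ 0#

  swapRows : ∀ {n} → Matrix n → Fin n → Fin n → Matrix n
  swapRows M i j = M [ i ]≔ M j [ j ]≔ M i

  -- With W x y the matrix M with rows i, j replaced by x, y:
  -- 0 = det W (u+v) (u+v) = det W u u + det W u v + det W v u + det W v v = det M + det (swapRows M i j).
  alternating⇒det-swapRows : ∀ {n} → Alternating n →
                             ∀ (M : Matrix n) {i j} → i ≢ j → det 𝔽 (swapRows M i j) ≡ - det 𝔽 M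
  alternating⇒det-swapRows {n} alternating M {i} {j} i≢j = +-inverseˡ-unique _ _ (begin
    det 𝔽 (W v u) + det 𝔽 M
      ≡⟨ +-comm _ _ ⟩
    det 𝔽 M + det 𝔽 (W v u)
      ≡⟨ sym (cong₂ _+_ (trans (cong (_+ det 𝔽 M) (W-repeated u)) (+-identityˡ _))
                        (trans (cong (det 𝔽 (W v u) +_) (W-repeated v)) (+-identityʳ _))) ⟩
    (det 𝔽 (W u u) + det 𝔽 M) + (det 𝔽 (W v u) + det 𝔽 (W v v))
      ≡⟨ cong₂ (λ x y → (det 𝔽 (W u u) + x) + y) (sym (det-cong W-id))
                                                 (sym (det-additiveAt (M [ i ]≔ v) j u v)) ⟩
    (det 𝔽 (W u u) + det 𝔽 (W u v)) + det 𝔽 (W v s)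
      ≡⟨ cong (_+ det 𝔽 (W v s)) (sym (det-additiveAt (M [ i ]≔ u) j u v)) ⟩
    det 𝔽 (W u s) + det 𝔽 (W v s)
      ≡⟨ sym (W-additiveᵢ s) ⟩
    det 𝔽 (W s s)
      ≡⟨ W-repeated s ⟩
    0# ∎)
    where
    u = M i
    v = M j
    s = λ k → u k + v k

    W : Vector Carrier n → Vector Carrier n → Matrix n
    W x y = M [ i ]≔ x [ j ]≔ y

    W-id : ∀ a → W u v a ≗ M a
    W-id a k = trans (≔-cong (≔-id M i) j v a k) (≔-id M j a k)

    W-repeated : ∀ x → det 𝔽 (W x x) ≡ 0#
    W-repeated x = alternating (W x x) i≢j
                     (cong-app (trans (≔≔-first M x x i≢j) (sym (updateAt-updates j (M [ i ]≔ x)))))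

    W-commute : ∀ x y → det 𝔽 (W x y) ≡ det 𝔽 (M [ j ]≔ y [ i ]≔ x)
    W-commute x y = det-cong (cong-app ∘ updateAt-commutes j i (i≢j ∘ sym) M)

    W-additiveᵢ : ∀ y → det 𝔽 (W s y) ≡ det 𝔽 (W u y) + det 𝔽 (W v y)
    W-additiveᵢ y = begin
      det 𝔽 (W s y)
        ≡⟨ W-commute s y ⟩
      det 𝔽 (M [ j ]≔ y [ i ]≔ s)
        ≡⟨ det-additiveAt (M [ j ]≔ y) i u v ⟩
      det 𝔽 (M [ j ]≔ y [ i ]≔ u) + det 𝔽 (M [ j ]≔ y [ i ]≔ v)
        ≡⟨ sym (cong₂ _+_ (W-commute u y) (W-commute v y)) ⟩
      det 𝔽 (W u y) + det 𝔽 (W v y) ∎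

  -- Swapping rows 1 and j+1 reduces equal rows 0 and j+1 to equal leading rows; on the minors it is a swap
  -- of rows 0 and j, which negates them.
  det-equalRow₀ : ∀ {n} → Alternating n → ∀ (M : Matrix (suc n)) j → M zero ≗ M (suc j) → det 𝔽 M ≡ 0#
  det-equalRow₀ {suc n} alternating M zero    M₀≗M₁ = det-equalRows₀₁ M (sym ∘ M₀≗M₁)
  det-equalRow₀ {suc n} alternating M (suc j) M₀≗Mⱼ = begin
    det 𝔽 M      ≡⟨ sym (-‿involutive _) ⟩
    - - det 𝔽 M  ≡⟨ cong -_ (sym (det-negateMinors M M′ (λ _ → refl) minors)) ⟩
    - det 𝔽 M′   ≡⟨ cong -_ (det-equalRows₀₁ M′ M′₁≗M′₀) ⟩
    - 0#         ≡⟨ -0#≈0# ⟩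
    0#           ∎
    where
    M′ = swapRows M (suc zero) (suc (suc j))

    M′₁≗M′₀ : M′ (suc zero) ≗ M′ zero
    M′₁≗M′₀ k = trans (cong-app (≔≔-first M {suc zero} {suc (suc j)} (M (suc (suc j))) (M (suc zero)) (λ ())) k)
                      (sym (M₀≗Mⱼ k))

    minors : ∀ k → det 𝔽 (minor M′ k) ≡ - det 𝔽 (minor M k)
    minors k = trans (det-cong λ a c →
                       trans (minor-≔ (M [ suc zero ]≔ M (suc (suc j))) (suc j) (M (suc zero)) k a c)
                             (≔-cong (minor-≔ M zero (M (suc (suc j))) k) (suc j) (removeAt (M (suc zero)) k) a c))
                     (alternating⇒det-swapRows alternating (minor M k) {zero} {suc j} (λ ()))

  alternating-suc : ∀ {n} → Alternating n → Alternating (suc n)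
  alternating-suc alternating M {zero}  {zero}  0≢0 _     = ⊥-elim (0≢0 refl)
  alternating-suc alternating M {zero}  {suc j} _   M₀≗Mⱼ = det-equalRow₀ alternating M j M₀≗Mⱼ
  alternating-suc alternating M {suc i} {zero}  _   Mᵢ≗M₀ = det-equalRow₀ alternating M i (sym ∘ Mᵢ≗M₀)
  alternating-suc alternating M {suc i} {suc j} i≢j Mᵢ≗Mⱼ =
    ∑-zero λ k → sgn-*-≡0 (toℕ k) (M zero k) (alternating (minor M k) (i≢j ∘ cong suc) (Mᵢ≗Mⱼ ∘ punchIn k))

  det-equalRows : ∀ {n} → Alternating n
  det-equalRows {zero}  M {()}
  det-equalRows {suc n} = alternating-suc det-equalRows

  addRow : ∀ {n} → Matrix n → Fin n → Carrier → Fin n → Matrix n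
  addRow M a c b = M [ b ]≔ (λ k → M b k + c * M a k)

  det-addRow : ∀ {n} (M : Matrix n) {a b} c → a ≢ b → det 𝔽 (addRow M a c b) ≡ det 𝔽 M
  det-addRow M {a} {b} c a≢b = begin
    det 𝔽 (addRow M a c b)
      ≡⟨ det-linearAt M b c (M b) (M a) _ (λ _ → refl) ⟩
    det 𝔽 (M [ b ]≔ M b) + c * det 𝔽 (M [ b ]≔ M a)
      ≡⟨ cong₂ (λ x y → x + c * y) (det-cong (≔-id M b)) repeated ⟩
    det 𝔽 M + c * 0#
      ≡⟨ trans (cong (det 𝔽 M +_) (zeroʳ c)) (+-identityʳ _) ⟩
    det 𝔽 M ∎
    where
    repeated : det 𝔽 (M [ b ]≔ M a) ≡ 0#
    repeated = det-equalRows (M [ b ]≔ M a) a≢b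
                 (cong-app (trans (updateAt-minimal a b M a≢b) (sym (updateAt-updates b M))))

  -- Gaussian elimination

  infixl 7 _*ᵥ_
  _*ᵥ_ : ∀ {m n} → (Fin m → Fin n → Carrier) → Vector Carrier n → Vector Carrier m
  (A *ᵥ x) i = ∑ 𝔽 (λ j → A i j * x j)

  0ᵥ : ∀ {n} → Vector Carrier n
  0ᵥ = const 0#

  TrivialKernel : ∀ {m n} → (Fin m → Fin n → Carrier) → Set
  TrivialKernel A = ∀ x → A *ᵥ x ≗ 0ᵥ → x ≗ 0ᵥ

  *ᵥ-cong : ∀ {m n} (A : Fin m → Fin n → Carrier) {x y} → x ≗ y → A *ᵥ x ≗ A *ᵥ y
  *ᵥ-cong A x≗y i = ∑-cong (λ j → cong (A i j *_) (x≗y j))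

  *ᵥ-0ᵥ : ∀ {m n} (A : Fin m → Fin n → Carrier) → A *ᵥ 0ᵥ ≗ 0ᵥ
  *ᵥ-0ᵥ A i = ∑-zero (λ j → zeroʳ (A i j))

  *ᵥ-sub : ∀ {m n} (A : Fin m → Fin n → Carrier) x y i →
           (A *ᵥ (λ j → x j + - y j)) i ≡ (A *ᵥ x) i + - (A *ᵥ y) i
  *ᵥ-sub A x y i = begin
    ∑ 𝔽 (λ j → A i j * (x j + - y j))
      ≡⟨ ∑-cong (λ j → trans (distribˡ (A i j) (x j) (- y j)) (cong (A i j * x j +_) (sym (-‿distribʳ-* _ _)))) ⟩
    ∑ 𝔽 (λ j → A i j * x j + - (A i j * y j))
      ≡⟨ ∑-distrib-+ (λ j → A i j * x j) (λ j → - (A i j * y j)) ⟩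
    (A *ᵥ x) i + ∑ 𝔽 (λ j → - (A i j * y j))
      ≡⟨ cong ((A *ᵥ x) i +_) (sym (-‿distrib-∑ (λ j → A i j * y j))) ⟩
    (A *ᵥ x) i + - (A *ᵥ y) i ∎

  -- The two invariants of row additions.
  infix 4 _∼_
  record _∼_ {n} (M N : Matrix n) : Set where
    constructor _,_
    field
      det≡    : det 𝔽 M ≡ det 𝔽 N
      kernel⇔ : ∀ x → (M *ᵥ x ≗ 0ᵥ) ⇔ (N *ᵥ x ≗ 0ᵥ)

  ∼-trans : ∀ {n} {M N L : Matrix n} → M ∼ N → N ∼ L → M ∼ L
  ∼-trans (det₁ , ker₁) (det₂ , ker₂) = trans det₁ det₂ , λ x → ⇔.trans (ker₁ x) (ker₂ x)

  ≗⇒∼ : ∀ {n} {M N : Matrix n} → (∀ i → M i ≗ N i) → M ∼ N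
  ≗⇒∼ {M = M} {N} M≗N = det-cong M≗N , λ x → mk⇔ (λ Mx≗0 i → trans (Nx≡Mx x i) (Mx≗0 i))
                                                  (λ Nx≗0 i → trans (sym (Nx≡Mx x i)) (Nx≗0 i))
    where
    Nx≡Mx : ∀ x i → (N *ᵥ x) i ≡ (M *ᵥ x) i
    Nx≡Mx x i = ∑-cong (λ j → cong (_* x j) (sym (M≗N i j)))

  ∼⇒trivialKernel⇔ : ∀ {n} {M N : Matrix n} → M ∼ N → TrivialKernel M ⇔ TrivialKernel N
  ∼⇒trivialKernel⇔ (_ , kernel⇔) = mk⇔ (λ trivial x → trivial x ∘ Equivalence.from (kernel⇔ x))
                                        (λ trivial x → trivial x ∘ Equivalence.to (kernel⇔ x))

  addRow-∼ : ∀ {n} (M : Matrix n) {a b} c → a ≢ b → M ∼ addRow M a c b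
  addRow-∼ M {a} {b} c a≢b = sym (det-addRow M c a≢b) , λ x → mk⇔ (to x) (from x)
    where
    N = addRow M a c b

    rowᵇ : ∀ x → (N *ᵥ x) b ≡ (M *ᵥ x) b + c * (M *ᵥ x) a
    rowᵇ x = begin
      ∑ 𝔽 (λ k → N b k * x k)
        ≡⟨ ∑-cong (λ k → cong (_* x k) (cong-app (updateAt-updates b M) k)) ⟩
      ∑ 𝔽 (λ k → (M b k + c * M a k) * x k)
        ≡⟨ ∑-cong (λ k → trans (distribʳ (x k) (M b k) _) (cong (M b k * x k +_) (*-assoc c (M a k) (x k)))) ⟩
      ∑ 𝔽 (λ k → M b k * x k + c * (M a k * x k))
        ≡⟨ ∑-linear (λ k → M b k * x k) c (λ k → M a k * x k) ⟩
      (M *ᵥ x) b + c * (M *ᵥ x) a ∎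

    rowʳ : ∀ x {r} → r ≢ b → (N *ᵥ x) r ≡ (M *ᵥ x) r
    rowʳ x {r} r≢b = ∑-cong (λ k → cong (_* x k) (cong-app (updateAt-minimal r b M r≢b) k))

    to : ∀ x → M *ᵥ x ≗ 0ᵥ → N *ᵥ x ≗ 0ᵥ
    to x Mx≗0 r with r Fin.≟ b
    ... | yes refl = trans (rowᵇ x) (trans (cong₂ (λ u v → u + c * v) (Mx≗0 r) (Mx≗0 a))
                                           (trans (cong (0# +_) (zeroʳ c)) (+-identityˡ 0#)))
    ... | no  r≢b  = trans (rowʳ x r≢b) (Mx≗0 r)

    from : ∀ x → N *ᵥ x ≗ 0ᵥ → M *ᵥ x ≗ 0ᵥ
    from x Nx≗0 r with r Fin.≟ b
    ... | yes refl = begin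
      (M *ᵥ x) r                   ≡⟨ sym (+-identityʳ _) ⟩
      (M *ᵥ x) r + 0#              ≡⟨ cong ((M *ᵥ x) r +_) (sym (trans (cong (c *_) Mxₐ≡0) (zeroʳ c))) ⟩
      (M *ᵥ x) r + c * (M *ᵥ x) a  ≡⟨ sym (rowᵇ x) ⟩
      (N *ᵥ x) r                   ≡⟨ Nx≗0 r ⟩
      0#                           ∎
      where
      Mxₐ≡0 : (M *ᵥ x) a ≡ 0#
      Mxₐ≡0 = trans (sym (rowʳ x a≢b)) (Nx≗0 a)
    ... | no  r≢b  = trans (sym (rowʳ x r≢b)) (Nx≗0 r)

  addMultiplesOfRow₀ : ∀ {n} → Matrix (suc n) → Vector Carrier n → Matrix (suc n)
  addMultiplesOfRow₀ M c zero    = M zero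
  addMultiplesOfRow₀ M c (suc r) = λ k → M (suc r) k + c r * M zero k

  addMultiplesOfRow₀-cong : ∀ {n} (M : Matrix (suc n)) {c d} → c ≗ d →
                            ∀ i → addMultiplesOfRow₀ M c i ≗ addMultiplesOfRow₀ M d i
  addMultiplesOfRow₀-cong M c≗d zero    k = refl
  addMultiplesOfRow₀-cong M c≗d (suc r) k = cong (λ a → M (suc r) k + a * M zero k) (c≗d r)

  infixl 8 _↾_
  _↾_ : ∀ {n} → Vector Carrier n → ℕ → Vector Carrier n
  (c ↾ t) r with toℕ r ℕ.<? t
  ... | yes _ = c r
  ... | no  _ = 0#

  ↾-below : ∀ {n} (c : Vector Carrier n) {t r} → toℕ r ℕ.< t → (c ↾ t) r ≡ c r
  ↾-below c {t} {r} r<t with toℕ r ℕ.<? t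
  ... | yes _   = refl
  ... | no  r≮t = ⊥-elim (r≮t r<t)

  ↾-above : ∀ {n} (c : Vector Carrier n) {t r} → ¬ toℕ r ℕ.< t → (c ↾ t) r ≡ 0#
  ↾-above c {t} {r} r≮t with toℕ r ℕ.<? t
  ... | yes r<t = ⊥-elim (r≮t r<t)
  ... | no  _   = refl

  ↾-suc : ∀ {n} (c : Vector Carrier n) {t r} → toℕ r ≢ t → (c ↾ suc t) r ≡ (c ↾ t) r
  ↾-suc c {t} {r} r≢t with toℕ r ℕ.<? t
  ... | yes r<t = ↾-below c (ℕ.m<n⇒m<1+n r<t)
  ... | no  r≮t = ↾-above c (λ r<1+t → r≮t (ℕ.≤∧≢⇒< (ℕ.≤-pred r<1+t) r≢t))

  -- One row at a time: after t row additions the rows below row 0 with index < t are done.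
  addMultiplesOfRow₀-∼ : ∀ {n} (M : Matrix (suc n)) c → M ∼ addMultiplesOfRow₀ M c
  addMultiplesOfRow₀-∼ {n} M c =
    ∼-trans (prefix n) (≗⇒∼ (addMultiplesOfRow₀-cong M (λ r → ↾-below c (Fin.toℕ<n r))))
    where
    prefix : ∀ t → M ∼ addMultiplesOfRow₀ M (c ↾ t)
    prefix zero = ≗⇒∼ λ where
      zero    k → refl
      (suc r) k → sym (trans (cong (λ a → M (suc r) k + a * M zero k) (↾-above c {0} {r} (λ ())))
                             (trans (cong (M (suc r) k +_) (zeroˡ _)) (+-identityʳ _)))
    prefix (suc t) with t ℕ.<? n
    ... | no  t≮n = ∼-trans (prefix t) (≗⇒∼ (addMultiplesOfRow₀-cong M {c ↾ t} {c ↾ suc t} λ r →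
                      sym (↾-suc c {t} {r} (λ r≡t → t≮n (subst (ℕ._< n) r≡t (Fin.toℕ<n r))))))
    ... | yes t<n = ∼-trans (prefix t) (∼-trans (addRow-∼ N {zero} {suc r} (c r) (λ ())) (≗⇒∼ step))
      where
      r = Fin.fromℕ< t<n
      r≡t : toℕ r ≡ t
      r≡t = Fin.toℕ-fromℕ< t<n
      N = addMultiplesOfRow₀ M (c ↾ t)
      step : ∀ i → addRow N zero (c r) (suc r) i ≗ addMultiplesOfRow₀ M (c ↾ suc t) i
      step zero    k = refl
      step (suc a) k with a Fin.≟ r
      ... | yes refl = begin
        addRow N zero (c a) (suc a) (suc a) k
          ≡⟨ cong-app (updateAt-updates (suc a) N) k ⟩
        (M (suc a) k + (c ↾ t) a * M zero k) + c a * M zero k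
          ≡⟨ cong (λ x → (M (suc a) k + x * M zero k) + c a * M zero k) (↾-above c (ℕ.<-irrefl r≡t)) ⟩
        (M (suc a) k + 0# * M zero k) + c a * M zero k
          ≡⟨ cong (_+ c a * M zero k) (trans (cong (M (suc a) k +_) (zeroˡ _)) (+-identityʳ _)) ⟩
        M (suc a) k + c a * M zero k
          ≡⟨ cong (λ x → M (suc a) k + x * M zero k) (sym (↾-below c (ℕ.≤-reflexive (cong suc r≡t)))) ⟩
        M (suc a) k + (c ↾ suc t) a * M zero k ∎
      ... | no  a≢r  = trans (cong-app (updateAt-minimal (suc a) (suc r) N (a≢r ∘ Fin.suc-injective)) k)
                             (cong (λ x → M (suc a) k + x * M zero k)
                                   (sym (↾-suc c (λ a≡t → a≢r (Fin.toℕ-injective (trans a≡t (sym r≡t)))))))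

  record FirstColumnReduced {n} (M : Matrix (suc n)) : Set where
    field
      reduced  : Matrix (suc n)
      ∼reduced : M ∼ reduced
      pivot≢0  : reduced zero zero ≢ 0#
      below≡0  : ∀ i → reduced (suc i) zero ≡ 0#

  clearBelowPivot : ∀ {n} (M : Matrix (suc n)) → M zero zero ≢ 0# → FirstColumnReduced M
  clearBelowPivot M p≢0 = record
    { reduced  = addMultiplesOfRow₀ M c
    ; ∼reduced = addMultiplesOfRow₀-∼ M c
    ; pivot≢0  = p≢0
    ; below≡0  = cleared
    }
    where
    p = M zero zero
    c = λ r → - (M (suc r) zero * p ⁻¹)
    cleared : ∀ r → M (suc r) zero + c r * p ≡ 0#
    cleared r = begin
      m + - (m * p ⁻¹) * p    ≡⟨ cong (m +_) (sym (-‿distribˡ-* _ _)) ⟩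
      m + - (m * p ⁻¹ * p)    ≡⟨ cong (λ x → m + - x) (*-assoc _ _ _) ⟩
      m + - (m * (p ⁻¹ * p))  ≡⟨ cong (λ x → m + - (m * x)) (trans (*-comm _ _) (inverseʳ p p≢0)) ⟩
      m + - (m * 1#)          ≡⟨ cong (λ x → m + - x) (*-identityʳ m) ⟩
      m + - m                 ≡⟨ -‿inverseʳ m ⟩
      0#                      ∎
      where m = M (suc r) zero

  -- If the top entry vanishes, first add the pivot row i to row 0.
  reduceFirstColumn : ∀ {n} (M : Matrix (suc n)) i → M i zero ≢ 0# → FirstColumnReduced M
  reduceFirstColumn M i Mᵢ₀≢0 with M zero zero ≟ 0#
  ... | no  M₀₀≢0 = clearBelowPivot M M₀₀≢0
  ... | yes M₀₀≡0 = record
    { reduced  = reduced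
    ; ∼reduced = ∼-trans (addRow-∼ M 1# i≢0) ∼reduced
    ; pivot≢0  = pivot≢0
    ; below≡0  = below≡0
    }
    where
    i≢0 : i ≢ zero
    i≢0 refl = Mᵢ₀≢0 M₀₀≡0
    newPivot≢0 : M zero zero + 1# * M i zero ≢ 0#
    newPivot≢0 = Mᵢ₀≢0 ∘ trans (sym (trans (cong (_+ 1# * M i zero) M₀₀≡0)
                                           (trans (+-identityˡ _) (*-identityˡ _))))
    open FirstColumnReduced (clearBelowPivot (addRow M i 1# zero) newPivot≢0)

  trivialKernel-firstColumn : ∀ {n} (M : Matrix (suc n)) → M zero zero ≢ 0# → (∀ i → M (suc i) zero ≡ 0#) →
                              TrivialKernel M ⇔ TrivialKernel (λ i k → M (suc i) (suc k))
  trivialKernel-firstColumn {n} M p≢0 below≡0 = mk⇔ to from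
    where
    p = M zero zero
    N : Matrix n
    N i k = M (suc i) (suc k)
    s : Vector Carrier n → Carrier
    s y = ∑ 𝔽 (λ k → M zero (suc k) * y k)

    lowerRows : ∀ x i → (M *ᵥ x) (suc i) ≡ (N *ᵥ (x ∘ suc)) i
    lowerRows x i = trans (cong (λ m → m * x zero + (N *ᵥ (x ∘ suc)) i) (below≡0 i))
                          (trans (cong (_+ (N *ᵥ (x ∘ suc)) i) (zeroˡ _)) (+-identityˡ _))

    to : TrivialKernel M → TrivialKernel N
    to trivial y Ny≗0 k = trivial x Mx≗0 (suc k)
      where
      x = - (p ⁻¹ * s y) ∷ y
      Mx≗0 : M *ᵥ x ≗ 0ᵥ
      Mx≗0 zero = begin
        p * - (p ⁻¹ * s y) + s y    ≡⟨ cong (_+ s y) (sym (-‿distribʳ-* p _)) ⟩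
        - (p * (p ⁻¹ * s y)) + s y  ≡⟨ cong (λ z → - z + s y) (sym (*-assoc p (p ⁻¹) (s y))) ⟩
        - (p * p ⁻¹ * s y) + s y    ≡⟨ cong (λ z → - (z * s y) + s y) (inverseʳ p p≢0) ⟩
        - (1# * s y) + s y          ≡⟨ cong (λ z → - z + s y) (*-identityˡ (s y)) ⟩
        - s y + s y                 ≡⟨ -‿inverseˡ (s y) ⟩
        0#                          ∎
      Mx≗0 (suc i) = trans (lowerRows x i) (Ny≗0 i)

    tail≗0 : TrivialKernel N → ∀ x → M *ᵥ x ≗ 0ᵥ → x ∘ suc ≗ 0ᵥ
    tail≗0 trivial x Mx≗0 = trivial (x ∘ suc) (λ i → trans (sym (lowerRows x i)) (Mx≗0 (suc i)))

    from : TrivialKernel N → TrivialKernel M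
    from trivial x Mx≗0 (suc k) = tail≗0 trivial x Mx≗0 k
    from trivial x Mx≗0 zero    = x≢0⇒x*y≡0⇒y≡0 p≢0 (begin
      p * x zero                ≡⟨ sym (+-identityʳ _) ⟩
      p * x zero + 0#           ≡⟨ cong (p * x zero +_) (sym (∑-zero λ k →
                                     trans (cong (M zero (suc k) *_) (tail≗0 trivial x Mx≗0 k)) (zeroʳ _))) ⟩
      p * x zero + s (x ∘ suc)  ≡⟨ Mx≗0 zero ⟩
      0#                        ∎)

  ≢0-cong : ∀ {x y} → x ≡ y → (x ≢ 0#) ⇔ (y ≢ 0#)
  ≢0-cong x≡y = mk⇔ (λ x≢0 → x≢0 ∘ trans x≡y) (λ y≢0 → y≢0 ∘ trans (sym x≡y))

  *-≢0⇔ : ∀ {x y} → x ≢ 0# → (x * y ≢ 0#) ⇔ (y ≢ 0#)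
  *-≢0⇔ {x} x≢0 = mk⇔ (λ xy≢0 y≡0 → xy≢0 (trans (cong (x *_) y≡0) (zeroʳ x)))
                      (x≢0∧y≢0⇒x*y≢0 x≢0)

  det≢0⇔trivialKernel : ∀ {n} (M : Matrix n) → (det 𝔽 M ≢ 0#) ⇔ TrivialKernel M
  det≢0⇔trivialKernel {zero}  M = mk⇔ (λ _ _ _ ()) (λ _ 1≡0 → 0≢1 (sym 1≡0))
  det≢0⇔trivialKernel {suc n} M with Fin.all? (λ i → M i zero ≟ 0#)
  ... | yes column≡0 = mk⇔ (λ det≢0 → ⊥-elim (det≢0 (det-zeroColumn M column≡0)))
                           (λ trivial → ⊥-elim (0≢1 (sym (trivial e₀ Me₀≗0 zero))))
    where
    e₀ : Vector Carrier (suc n)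
    e₀ = 1# ∷ 0ᵥ
    Me₀≗0 : M *ᵥ e₀ ≗ 0ᵥ
    Me₀≗0 i = trans (cong₂ _+_ (trans (cong (_* 1#) (column≡0 i)) (zeroˡ 1#))
                               (*ᵥ-0ᵥ (λ i k → M i (suc k)) i))
                    (+-identityˡ 0#)
  ... | no ¬column≡0 with Fin.¬∀⟶∃¬ (suc n) _ (λ i → M i zero ≟ 0#) ¬column≡0
  ...   | i , Mᵢ₀≢0 = begin⇔
    det 𝔽 M ≢ 0#                      ≈⟨ ≢0-cong (trans (_∼_.det≡ ∼reduced) (det-firstColumn reduced below≡0)) ⟩
    reduced zero zero * det 𝔽 N ≢ 0#  ≈⟨ *-≢0⇔ pivot≢0 ⟩
    det 𝔽 N ≢ 0#                      ≈⟨ det≢0⇔trivialKernel N ⟩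
    TrivialKernel N                   ≈⟨ trivialKernel-firstColumn reduced pivot≢0 below≡0 ⟨
    TrivialKernel reduced             ≈⟨ ∼⇒trivialKernel⇔ ∼reduced ⟨
    TrivialKernel M                   ∎⇔
    where
    open FirstColumnReduced (reduceFirstColumn M i Mᵢ₀≢0)
    open SetoidReasoning (⇔.⇔-setoid 0ℓ)
      using (step-≈-⟩; step-≈-⟨) renaming (begin_ to begin⇔_; _∎ to _∎⇔)
    N : Matrix n
    N i k = reduced (suc i) (suc k)

  -- Cellular automata as matrices

  sumℕ : ℕ → (ℕ → Carrier) → Carrier
  sumℕ n g = ∑ 𝔽 {n} (g ∘ toℕ)

  sumℕ-cong : ∀ n {g h : ℕ → Carrier} → (∀ k → k ℕ.< n → g k ≡ h k) → sumℕ n g ≡ sumℕ n h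
  sumℕ-cong zero    g≡h = refl
  sumℕ-cong (suc n) g≡h = cong₂ _+_ (g≡h 0 ℕ.z<s) (sumℕ-cong n (λ k k<n → g≡h (suc k) (ℕ.s<s k<n)))

  sumℕ-+ : ∀ m n (g : ℕ → Carrier) → sumℕ (m ℕ.+ n) g ≡ sumℕ m g + sumℕ n (λ k → g (m ℕ.+ k))
  sumℕ-+ zero    n g = sym (+-identityˡ _)
  sumℕ-+ (suc m) n g = trans (cong (g 0 +_) (sumℕ-+ m n (g ∘ suc))) (sym (+-assoc _ _ _))

  sumℕ-dropInitialZeros : ∀ m n (g : ℕ → Carrier) → (∀ k → k ℕ.< m → g k ≡ 0#) →
                          sumℕ (m ℕ.+ n) g ≡ sumℕ n (λ k → g (m ℕ.+ k))
  sumℕ-dropInitialZeros m n g initial≡0 = begin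
    sumℕ (m ℕ.+ n) g
      ≡⟨ sumℕ-+ m n g ⟩
    sumℕ m g + sumℕ n (λ k → g (m ℕ.+ k))
      ≡⟨ cong (_+ sumℕ n (λ k → g (m ℕ.+ k))) (trans (sumℕ-cong m initial≡0) (∑-zero {m} (λ _ → refl))) ⟩
    0# + sumℕ n (λ k → g (m ℕ.+ k))
      ≡⟨ +-identityˡ _ ⟩
    sumℕ n (λ k → g (m ℕ.+ k)) ∎

  sumℕ-dropFinalZeros : ∀ m n (g : ℕ → Carrier) → (∀ k → g (m ℕ.+ k) ≡ 0#) → sumℕ (m ℕ.+ n) g ≡ sumℕ m g
  sumℕ-dropFinalZeros m n g final≡0 = begin
    sumℕ (m ℕ.+ n) g                         ≡⟨ sumℕ-+ m n g ⟩
    sumℕ m g + sumℕ n (λ k → g (m ℕ.+ k))    ≡⟨ cong (sumℕ m g +_) (∑-zero {n} (final≡0 ∘ toℕ)) ⟩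
    sumℕ m g + 0#                            ≡⟨ +-identityʳ _ ⟩
    sumℕ m g                                 ∎

  at-lookup : ∀ {n} (v : Vec Carrier n) k → at 𝔽 v (toℕ k) ≡ lookup v k
  at-lookup (x Vec.∷ v) zero    = refl
  at-lookup (x Vec.∷ v) (suc k) = at-lookup v k

  at-≥ : ∀ {n} (v : Vec Carrier n) {m} → n ℕ.≤ m → at 𝔽 v m ≡ 0#
  at-≥ Vec.[]       _          = refl
  at-≥ (x Vec.∷ v) (ℕ.s≤s n≤m) = at-≥ v n≤m

  band-< : ∀ r a {i j} → j ℕ.< i → band 𝔽 r a i j ≡ 0#
  band-< r a {i} {j} j<i with i ℕ.≤? j
  ... | yes i≤j = ⊥-elim (ℕ.<⇒≱ j<i i≤j)
  ... | no  _   = refl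

  band-+ : ∀ r a i k → band 𝔽 r a i (i ℕ.+ k) ≡ at 𝔽 a k
  band-+ r a i k with i ℕ.≤? i ℕ.+ k
  ... | yes _   = cong (at 𝔽 a) (ℕ.m+n∸m≡n i k)
  ... | no  i≰i+k = ⊥-elim (i≰i+k (ℕ.m≤m+n i k))

  Represents : ∀ {m n} → (Fin m → Fin n → Carrier) → (Vec Carrier n → Vec Carrier m) → Set
  Represents A F = ∀ v i → lookup (F v) i ≡ (A *ᵥ lookup v) i

  -- Row i of caMatrix is a₀ … a₂ᵣ shifted to columns i … i+2r; it fits because i < 2r.
  caMatrix-represents : ∀ r (a : Vec Carrier (suc (2 ℕ.* r))) → Represents (caMatrix 𝔽 r a) (linearCA 𝔽 r a)
  caMatrix-represents r a v i = begin
    lookup (linearCA 𝔽 r a v) i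
      ≡⟨ VecP.lookup∘tabulate (λ i → linearRule 𝔽 r a (window 𝔽 r v (toℕ i))) i ⟩
    ∑ 𝔽 (λ k → lookup a k * lookup (window 𝔽 r v t) k)
      ≡⟨ ∑-cong (λ k → cong₂ _*_ (sym (at-lookup a k))
                                  (VecP.lookup∘tabulate (λ k → at 𝔽 v (t ℕ.+ toℕ k)) k)) ⟩
    sumℕ (suc 2r) (λ k → at 𝔽 a k * at 𝔽 v (t ℕ.+ k))
      ≡⟨ sumℕ-cong (suc 2r) (λ k _ → cong (_* at 𝔽 v (t ℕ.+ k)) (sym (band-+ r a t k))) ⟩
    sumℕ (suc 2r) (λ k → g (t ℕ.+ k))
      ≡⟨ sym (sumℕ-dropFinalZeros (suc 2r) w (λ k → g (t ℕ.+ k)) beyondBand≡0) ⟩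
    sumℕ (suc 2r ℕ.+ w) (λ k → g (t ℕ.+ k))
      ≡⟨ sym (sumℕ-dropInitialZeros t (suc 2r ℕ.+ w) g beforeBand≡0) ⟩
    sumℕ (t ℕ.+ (suc 2r ℕ.+ w)) g
      ≡⟨ cong (λ n → sumℕ n g) t+2r+1+w≡4r ⟩
    sumℕ (2r ℕ.+ 2r) g
      ≡⟨ ∑-cong (λ j → cong (band 𝔽 r a t (toℕ j) *_) (at-lookup v j)) ⟩
    (caMatrix 𝔽 r a *ᵥ lookup v) i ∎
    where
    2r = 2 ℕ.* r
    t = toℕ i
    g : ℕ → Carrier
    g j = band 𝔽 r a t j * at 𝔽 v j
    beyondBand≡0 : ∀ k → g (t ℕ.+ (suc 2r ℕ.+ k)) ≡ 0#
    beyondBand≡0 k = trans (cong (_* at 𝔽 v (t ℕ.+ (suc 2r ℕ.+ k)))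
                                 (trans (band-+ r a t _) (at-≥ a (ℕ.m≤m+n (suc 2r) k))))
                           (zeroˡ _)
    beforeBand≡0 : ∀ j → j ℕ.< t → g j ≡ 0#
    beforeBand≡0 j j<t = trans (cong (_* at 𝔽 v j) (band-< r a j<t)) (zeroˡ _)
    t+2r+1≤4r : t ℕ.+ suc 2r ℕ.≤ 2r ℕ.+ 2r
    t+2r+1≤4r = subst (ℕ._≤ 2r ℕ.+ 2r) (sym (ℕ.+-suc t 2r)) (ℕ.+-monoˡ-≤ 2r (Fin.toℕ<n i))
    w : ℕ
    w = proj₁ (ℕ.m≤n⇒∃[o]m+o≡n t+2r+1≤4r)
    t+2r+1+w≡4r : t ℕ.+ (suc 2r ℕ.+ w) ≡ 2r ℕ.+ 2r
    t+2r+1+w≡4r = trans (sym (ℕ.+-assoc t (suc 2r) w)) (proj₂ (ℕ.m≤n⇒∃[o]m+o≡n t+2r+1≤4r))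

  -- Orthogonality

  stack-*ᵥ≗0ᵥ : ∀ {m n} (A B : Fin m → Fin n → Carrier) x →
                (stack 𝔽 A B *ᵥ x ≗ 0ᵥ) ⇔ (A *ᵥ x ≗ 0ᵥ × B *ᵥ x ≗ 0ᵥ)
  stack-*ᵥ≗0ᵥ {m} A B x = mk⇔ (λ Sx≗0 → (λ i → trans (sym (upper i)) (Sx≗0 (i Fin.↑ˡ m)))
                                      , (λ i → trans (sym (lower i)) (Sx≗0 (m Fin.↑ʳ i))))
                               both
    where
    upper : ∀ i → (stack 𝔽 A B *ᵥ x) (i Fin.↑ˡ m) ≡ (A *ᵥ x) i
    upper i rewrite Fin.splitAt-↑ˡ m i m = refl
    lower : ∀ i → (stack 𝔽 A B *ᵥ x) (m Fin.↑ʳ i) ≡ (B *ᵥ x) i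
    lower i rewrite Fin.splitAt-↑ʳ m m i = refl
    both : A *ᵥ x ≗ 0ᵥ × B *ᵥ x ≗ 0ᵥ → stack 𝔽 A B *ᵥ x ≗ 0ᵥ
    both (Ax≗0 , Bx≗0) i with Fin.splitAt m i
    ... | inj₁ i′ = Ax≗0 i′
    ... | inj₂ i′ = Bx≗0 i′

  lookup-injective : ∀ {n} {u v : Vec Carrier n} → lookup u ≗ lookup v → u ≡ v
  lookup-injective {u = u} {v} u≗v =
    trans (sym (VecP.tabulate∘lookup u)) (trans (VecP.tabulate-cong u≗v) (VecP.tabulate∘lookup v))

  JointlyInjective : ∀ {m n} → (Vec Carrier n → Vec Carrier m) → (Vec Carrier n → Vec Carrier m) → Set
  JointlyInjective F G = ∀ u v → F u ≡ F v → G u ≡ G v → u ≡ v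

  jointlyInjective⇔trivialKernel : ∀ {m n} {A B : Fin m → Fin n → Carrier} {F G} →
    Represents A F → Represents B G → JointlyInjective F G ⇔ TrivialKernel (stack 𝔽 A B)
  jointlyInjective⇔trivialKernel {A = A} {B} {F} {G} A∼F B∼G = mk⇔ to from
    where
    image-≡ : ∀ {C H} → Represents C H → ∀ {u v} → C *ᵥ lookup u ≗ C *ᵥ lookup v → H u ≡ H v
    image-≡ C∼H {u} {v} Cu≗Cv = lookup-injective λ i → trans (C∼H u i) (trans (Cu≗Cv i) (sym (C∼H v i)))

    to : JointlyInjective F G → TrivialKernel (stack 𝔽 A B)
    to injective x Sx≗0 j = begin
      x j                        ≡⟨ sym (VecP.lookup∘tabulate x j) ⟩
      lookup (Vec.tabulate x) j  ≡⟨ cong (λ u → lookup u j) (injective _ _ (sameImage {A} {F} A∼F Ax≗0)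
                                                                          (sameImage {B} {G} B∼G Bx≗0)) ⟩
      lookup 𝟎 j                 ≡⟨ VecP.lookup-replicate j 0# ⟩
      0#                         ∎
      where
      𝟎 = Vec.replicate _ 0#
      Ax≗0 = proj₁ (Equivalence.to (stack-*ᵥ≗0ᵥ A B x) Sx≗0)
      Bx≗0 = proj₂ (Equivalence.to (stack-*ᵥ≗0ᵥ A B x) Sx≗0)
      sameImage : ∀ {C H} → Represents C H → C *ᵥ x ≗ 0ᵥ → H (Vec.tabulate x) ≡ H 𝟎
      sameImage {C} {H} C∼H Cx≗0 = image-≡ {C} {H} C∼H λ i → begin
        (C *ᵥ lookup (Vec.tabulate x)) i ≡⟨ *ᵥ-cong C (VecP.lookup∘tabulate x) i ⟩
        (C *ᵥ x) i                       ≡⟨ Cx≗0 i ⟩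
        0#                               ≡⟨ sym (*ᵥ-0ᵥ C i) ⟩
        (C *ᵥ 0ᵥ) i                      ≡⟨ *ᵥ-cong C (λ j → sym (VecP.lookup-replicate j 0#)) i ⟩
        (C *ᵥ lookup 𝟎) i                ∎

    from : TrivialKernel (stack 𝔽 A B) → JointlyInjective F G
    from trivial u v Fu≡Fv Gu≡Gv =
      lookup-injective (λ j → x∙y⁻¹≈ε⇒x≈y _ _ (trivial d Sd≗0 j))
      where
      d = λ j → lookup u j + - lookup v j
      kills : ∀ {C H} → Represents C H → H u ≡ H v → C *ᵥ d ≗ 0ᵥ
      kills {C} {H} C∼H Hu≡Hv i = begin
        (C *ᵥ d) i                                  ≡⟨ *ᵥ-sub C (lookup u) (lookup v) i ⟩
        (C *ᵥ lookup u) i + - (C *ᵥ lookup v) i     ≡⟨ sym (cong₂ (λ p q → p + - q) (C∼H u i) (C∼H v i)) ⟩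
        lookup (H u) i + - lookup (H v) i           ≡⟨ cong (λ w → lookup w i + - lookup (H v) i) Hu≡Hv ⟩
        lookup (H v) i + - lookup (H v) i           ≡⟨ -‿inverseʳ _ ⟩
        0#                                          ∎
      Sd≗0 : stack 𝔽 A B *ᵥ d ≗ 0ᵥ
      Sd≗0 = Equivalence.from (stack-*ᵥ≗0ᵥ A B d) (kills {A} {F} A∼F Fu≡Fv , kills {B} {G} B∼G Gu≡Gv)

  -- Only the bijectivity of φ matters, not the order it respects.
  orthogonal⇔jointlyInjective : ∀ {m} (I : MonotoneIndexing 𝔽 m) (F G : Vec Carrier (m ℕ.+ m) → Vec Carrier m) →
    Orthogonal (square 𝔽 I F) (square 𝔽 I G) ⇔ JointlyInjective F G
  orthogonal⇔jointlyInjective {m} I F G = mk⇔ to from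
    where
    open MonotoneIndexing I

    φ-injective : ∀ {x y} → φ x ≡ φ y → x ≡ y
    φ-injective {x} {y} φx≡φy = trans (sym (ψ∘φ x)) (trans (cong ψ φx≡φy) (ψ∘φ y))

    ψ-injective : ∀ {i j} → ψ i ≡ ψ j → i ≡ j
    ψ-injective {i} {j} ψi≡ψj = trans (sym (φ∘ψ i)) (trans (cong φ ψi≡ψj) (φ∘ψ j))

    square-φ : ∀ H xs ys → square 𝔽 I H (φ xs) (φ ys) ≡ φ (H (xs Vec.++ ys))
    square-φ H xs ys = cong (λ w → φ (H w)) (cong₂ Vec._++_ (ψ∘φ xs) (ψ∘φ ys))

    to : Orthogonal (square 𝔽 I F) (square 𝔽 I G) → JointlyInjective F G
    to orthogonal u v Fu≡Fv Gu≡Gv with Vec.splitAt m u | Vec.splitAt m v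
    ... | xs , ys , refl | zs , ws , refl
      with orthogonal (φ xs) (φ ys) (φ zs) (φ ws)
             (cong₂ _,_ (trans (square-φ F xs ys) (trans (cong φ Fu≡Fv) (sym (square-φ F zs ws))))
                        (trans (square-φ G xs ys) (trans (cong φ Gu≡Gv) (sym (square-φ G zs ws)))))
    ...   | φxs≡φzs , φys≡φws = cong₂ Vec._++_ (φ-injective φxs≡φzs) (φ-injective φys≡φws)

    from : JointlyInjective F G → Orthogonal (square 𝔽 I F) (square 𝔽 I G)
    from injective i₁ j₁ i₂ j₂ same =
      ψ-injective (VecP.++-injectiveˡ (ψ i₁) (ψ i₂) same-argument) ,
      ψ-injective (VecP.++-injectiveʳ (ψ i₁) (ψ i₂) same-argument)
      where
      same-argument : ψ i₁ Vec.++ ψ j₁ ≡ ψ i₂ Vec.++ ψ j₂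
      same-argument = injective _ _ (φ-injective (cong proj₁ same)) (φ-injective (cong proj₂ same))

open import Data.Nat using (_*_; _≤_)
open import Data.Fin using (fromℕ)
open FiniteField using (Carrier; 0#)

lemma4 : (𝔽 : FiniteField) (r : ℕ) → 1 ≤ r →
    (a b : Vec (Carrier 𝔽) (suc (2 * r))) →
    ¬ (lookup a zero ≡ 0# 𝔽) → ¬ (lookup a (fromℕ (2 * r)) ≡ 0# 𝔽) →
    ¬ (lookup b zero ≡ 0# 𝔽) → ¬ (lookup b (fromℕ (2 * r)) ≡ 0# 𝔽) →
    (I : MonotoneIndexing 𝔽 (2 * r)) →
    Orthogonal (square 𝔽 I (linearCA 𝔽 r a)) (square 𝔽 I (linearCA 𝔽 r b))
    ⇔ (¬ (det 𝔽 (stack 𝔽 (caMatrix 𝔽 r a) (caMatrix 𝔽 r b)) ≡ 0# 𝔽))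
lemma4 𝔽 r _ a b _ _ _ _ I = begin
  Orthogonal (square 𝔽 I (linearCA 𝔽 r a)) (square 𝔽 I (linearCA 𝔽 r b))
    ≈⟨ orthogonal⇔jointlyInjective 𝔽 I (linearCA 𝔽 r a) (linearCA 𝔽 r b) ⟩
  JointlyInjective 𝔽 (linearCA 𝔽 r a) (linearCA 𝔽 r b)
    ≈⟨ jointlyInjective⇔trivialKernel 𝔽 (caMatrix-represents 𝔽 r a) (caMatrix-represents 𝔽 r b) ⟩
  TrivialKernel 𝔽 (stack 𝔽 (caMatrix 𝔽 r a) (caMatrix 𝔽 r b))
    ≈⟨ det≢0⇔trivialKernel 𝔽 (stack 𝔽 (caMatrix 𝔽 r a) (caMatrix 𝔽 r b)) ⟨
  (¬ (det 𝔽 (stack 𝔽 (caMatrix 𝔽 r a) (caMatrix 𝔽 r b)) ≡ 0# 𝔽))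
    ∎
  where open SetoidReasoning (⇔.⇔-setoid 0ℓ)
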